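{- For every positive integer $d$, there are only finitely many (isomorphism types of) finite solvable groups $G$ for which $\Gamma_{sc}(G)$ has clique number $d$.
   Context: For a group $G$, the SCC-graph $\Gamma_{sc}(G)$ is the simple undirected graph whose vertices are the nontrivial conjugacy classes $x^G=\{gxg^{ -1}:g\in G\}$, $x\ne1$, where two distinct vertices $x^G,y^G$ are adjacent if there exist $x'\in x^G$, $y'\in y^G$ with $\langle x',y'\rangle$ solvable. The clique number of a graph is the number of vertices of a largest complete subgraph. -}

module Defs where

open import Data.Nat using (ℕ; _≤_)
open import Data.Fin using (Fin)
open import Data.Product using (Σ; _×_; _,_; ∃)
open import Data.Unit using (⊤)
open import Data.List using (List)
open import Relation.Nullary using (¬_)
open import Relation.Binary.PropositionalEquality using (_≡_)

record FinGroup : Set where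
  field
    order : ℕ
    _·_   : Fin order → Fin order → Fin order
    e     : Fin order
    inv   : Fin order → Fin order
    assoc : ∀ a b c → (a · b) · c ≡ a · (b · c)
    idˡ   : ∀ a → e · a ≡ a
    idʳ   : ∀ a → a · e ≡ a
    invˡ  : ∀ a → inv a · a ≡ e
    invʳ  : ∀ a → a · inv a ≡ e

module _ (G : FinGroup) where
  open FinGroup G

  Elt : Set
  Elt = Fin order

  Pred : Set₁
  Pred = Elt → Set

  IsSubgroup : Pred → Set
  IsSubgroup H = H e × (∀ a b → H a → H b → H (a · b)) × (∀ a → H a → H (inv a))

  data Gen₂ (x y : Elt) : Pred where
    gx  : Gen₂ x y x
    gy  : Gen₂ x y y
    ge  : Gen₂ x y e
    gmul : ∀ {a b} → Gen₂ x y a → Gen₂ x y b → Gen₂ x y (a · b)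
    ginv : ∀ {a} → Gen₂ x y a → Gen₂ x y (inv a)

  comm : Elt → Elt → Elt
  comm a b = ((a · b) · inv a) · inv b

  -- A subnormal series H = H₀ ⊵ H₁ ⊵ ... ⊵ Hₖ = 1 with abelian factors Hᵢ/Hᵢ₊₁
  data SolvSeries (H : Pred) : Set₁ where
    trivial : (∀ a → H a → a ≡ e) → SolvSeries H
    step    : (K : Pred) → IsSubgroup K
            → (∀ a → K a → H a)
            → (∀ a k → H a → K k → K ((a · k) · inv a))
            → (∀ a b → H a → H b → K (comm a b))
            → SolvSeries K → SolvSeries H

  SolvableSub : Pred → Set₁
  SolvableSub H = IsSubgroup H × SolvSeries H

  Conj : Elt → Elt → Set
  Conj x y = Σ Elt λ g → (g · x) · inv g ≡ y

  -- adjacency in the SCC-graph between x^G and y^G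
  SccAdj : Elt → Elt → Set₁
  SccAdj x y = Σ Elt λ x' → Σ Elt λ y' → Conj x x' × Conj y y' × SolvableSub (Gen₂ x' y')

  -- A clique of size m in Γ_sc(G), given by representatives v₁,…,vₘ of
  -- m pairwise distinct nontrivial conjugacy classes which are pairwise adjacent.
  IsClique : (m : ℕ) → (Fin m → Elt) → Set₁
  IsClique m v = (∀ i → ¬ (v i ≡ e))
               × (∀ i j → ¬ (i ≡ j) → ¬ Conj (v i) (v j))
               × (∀ i j → ¬ (i ≡ j) → SccAdj (v i) (v j))

  CliqueNumber : ℕ → Set₁
  CliqueNumber d = (Σ (Fin d → Elt) (IsClique d))
                 × (∀ m (v : Fin m → Elt) → IsClique m v → m ≤ d)

  Solvable : Set₁
  Solvable = SolvableSub (λ _ → ⊤)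

record _≅_ (G H : FinGroup) : Set where
  private
    module G = FinGroup G
    module H = FinGroup H
  field
    to   : Fin G.order → Fin H.order
    from : Fin H.order → Fin G.order
    from∘to : ∀ a → from (to a) ≡ a
    to∘from : ∀ b → to (from b) ≡ b
    hom  : ∀ a b → to (a G.· b) ≡ to a H.· to b

-- In a solvable group every subgroup, in particular every two-generated one, is
-- solvable, so the SCC-graph is complete and its clique number d is k − 1, where k is
-- the number of conjugacy classes. The class equation divided by |G| reads
-- Σ 1 / |C_G(xᵢ)| = 1 over class representatives, and Landau's argument bounds every
-- solution of Σᵢ 1 / cᵢ = p / q with k terms: the largest term is at least p / (k q),
-- and removing it leaves an equation of the same shape with k − 1 terms. Hence
-- |G| = |C_G(1)| is bounded in terms of d, and there are only finitely many group
-- tables of bounded order.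
module Submission where

open import Defs
open import Algebra.Bundles using (Group)
import Algebra.Properties.Group as GroupProperties
open import Data.Fin using (Fin; zero; suc; punchIn; punchOut)
open import Data.Fin.Permutation using (Permutation′; _⟨$⟩ʳ_; permutation)
open import Data.Fin.Properties
  using (_≟_; any?; all?; nonZeroIndex; punchIn-punchOut; punchInᵢ≢i; punchIn-injective)
open import Data.List using (List; []; _∷_; allFin; concatMap; map; upTo)
open import Data.List.Extrema.Nat using (argmax; f[xs]≤f[argmax])
open import Data.List.Membership.Propositional using (_∈_)
open import Data.List.Membership.Propositional.Properties using (∈-allFin; ∈-upTo⁺)
import Data.List.Relation.Unary.All as All
open import Data.List.Relation.Unary.Any as Any using (Any; here; there)
open import Data.List.Relation.Unary.Any.Properties using (concatMap⁺; map⁺)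
open import Data.Nat
  using (ℕ; zero; suc; _+_; _*_; _∸_; _≤_; z≤n; s≤s; NonZero; >-nonZero; >-nonZero⁻¹)
open import Data.Nat.Properties
  using ( +-*-semiring; +-mono-≤; *-mono-≤; *-monoˡ-≤; *-monoʳ-≤; *-cancelˡ-≤; *-assoc
        ; +-identityʳ; *-distribʳ-∸; m+n∸m≡n; m≤m+n; m≤n+m; m≤n*m; ≤-refl; ≤-trans
        ; ≤-reflexive; <-≤-trans; m*n≢0; m*n≢0⇒m≢0; m*n≢0⇒n≢0; module ≤-Reasoning)
open import Data.Nat.Tactic.RingSolver using (solve-∀)
open import Data.Product using (Σ; ∃; _×_; _,_; proj₁; proj₂)
open import Data.Unit using (tt)
open import Data.Vec.Functional as Vector using (removeAt)
open import Algebra.Properties.Semiring.Sum +-*-semiring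
  using (sum; sum-remove; sum-cong-≗; sum-replicate-zero; sum-permute; ∑-comm; *-distribʳ-sum)
open import Function using (_∘_; _⇔_; mk⇔; Equivalence)
open import Level using (Level; _⊔_; 0ℓ)
open import Relation.Binary.Bundles using (DecSetoid)
open import Relation.Binary.Core using (Rel)
open import Relation.Binary.PropositionalEquality
open import Relation.Nullary using (Dec; yes; no; ¬_; contradiction)
open import Relation.Nullary.Decidable using (_×-dec_)
open import Relation.Unary using (Decidable) renaming (Pred to Predicate)

private variable
  ℓ ℓ′ : Level
  A B : Set ℓ
  k : ℕ

-- Landau's bound

-- The largest of k terms summing to p / q has denominator c ≤ k q, and the other
-- k − 1 terms sum to a fraction with denominator c q ≤ k q².
landauBound : ℕ → ℕ → ℕ
landauBound zero    q = 0
landauBound (suc k) q = suc k * q + landauBound k (suc k * q * q)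

landauBound-mono-≤ : ∀ {m k q r} → m ≤ k → q ≤ r → landauBound m q ≤ landauBound k r
landauBound-mono-≤ z≤n       q≤r = z≤n
landauBound-mono-≤ (s≤s m≤k) q≤r =
  +-mono-≤ k*q≤ (landauBound-mono-≤ m≤k (*-mono-≤ k*q≤ q≤r))
  where k*q≤ = *-mono-≤ (s≤s m≤k) q≤r

argmax-index : (t : Fin (suc k) → ℕ) → Σ (Fin (suc k)) λ j → ∀ i → t i ≤ t j
argmax-index t = j , λ i → All.lookup (f[xs]≤f[argmax] {f = t} zero (allFin _)) (∈-allFin i)
  where j = argmax t zero (allFin _)

sum-≤-bound : (t : Fin k → ℕ) {M : ℕ} → (∀ i → t i ≤ M) → sum t ≤ k * M
sum-≤-bound {zero}  t bound = z≤n
sum-≤-bound {suc k} t bound = +-mono-≤ (bound zero) (sum-≤-bound (t ∘ suc) (bound ∘ suc))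

lookup≤sum : (t : Fin (suc k) → ℕ) (j : Fin (suc k)) → t j ≤ sum t
lookup≤sum t j = ≤-trans (m≤m+n (t j) _) (≤-reflexive (sym (sum-remove t)))

largest-part-bound : (h : Fin k → ℕ) {j : Fin k} {c p q n : ℕ} → (∀ i → h i ≤ h j) →
                     h j * c ≡ n → q * sum h ≡ p * n → .{{NonZero p}} → .{{NonZero (h j)}} →
                     c ≤ k * q
largest-part-bound {k} h {j} {c} {p} {q} {n} hj-max hc eq =
  *-cancelˡ-≤ (h j) (begin
    h j * c        ≡⟨ hc ⟩
    n              ≤⟨ m≤n*m n p ⟩
    p * n          ≡⟨ eq ⟨
    q * sum h      ≤⟨ *-monoʳ-≤ q (sum-≤-bound h hj-max) ⟩
    q * (k * h j)  ≡⟨ swap-outer q k (h j) ⟩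
    h j * (k * q)  ∎)
  where
  open ≤-Reasoning
  swap-outer : ∀ a b c → a * (b * c) ≡ c * (b * a)
  swap-outer = solve-∀

-- Σ_{i ≠ j} 1 / c i = p / q − 1 / c j = (c j p − q) / (c j q).
landau-remove : (h : Fin (suc k) → ℕ) (j : Fin (suc k)) {c p q n : ℕ} → h j * c ≡ n →
                q * sum h ≡ p * n → c * q * sum (removeAt h j) ≡ (c * p ∸ q) * n
landau-remove h j {c} {p} {q} {n} hc eq = begin
  c * q * s                  ≡⟨ m+n∸m≡n (q * n) _ ⟨
  q * n + c * q * s ∸ q * n  ≡⟨ cong (_∸ q * n) total ⟩
  c * p * n ∸ q * n          ≡⟨ *-distribʳ-∸ n (c * p) q ⟨
  (c * p ∸ q) * n            ∎
  where
  open ≡-Reasoning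
  s = sum (removeAt h j)
  distrib : ∀ a b c s → a * (b * c) + c * a * s ≡ c * a * (b + s)
  distrib = solve-∀
  total : q * n + c * q * s ≡ c * p * n
  total = begin
    q * n + c * q * s          ≡⟨ cong (λ m → q * m + c * q * s) hc ⟨
    q * (h j * c) + c * q * s  ≡⟨ distrib q (h j) c s ⟩
    c * q * (h j + s)          ≡⟨ cong (c * q *_) (sum-remove h) ⟨
    c * q * sum h              ≡⟨ *-assoc c q (sum h) ⟩
    c * (q * sum h)            ≡⟨ cong (c *_) eq ⟩
    c * (p * n)                ≡⟨ *-assoc c p n ⟨
    c * p * n                  ∎

-- Since h i = n / c i, the hypotheses say Σ 1 / c i = p / q.
landau : ∀ k (h c : Fin k → ℕ) {p q n : ℕ} .{{_ : NonZero q}} .{{_ : NonZero n}} →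
         (∀ i → h i * c i ≡ n) → q * sum h ≡ p * n → ∀ i → c i ≤ landauBound k q
landau (suc k) h c {p} {q} {n} {{_}} {{n≢0}} hc eq i with argmax-index h
... | j , hj-max = bound i
  where
  instance
    hj≢0 : NonZero (h j)
    hj≢0 = m*n≢0⇒m≢0 (h j) {{subst NonZero (sym (hc j)) n≢0}}
    cj≢0 : NonZero (c j)
    cj≢0 = m*n≢0⇒n≢0 (h j) {{subst NonZero (sym (hc j)) n≢0}}
    sum≢0 : NonZero (sum h)
    sum≢0 = >-nonZero (<-≤-trans (>-nonZero⁻¹ (h j)) (lookup≤sum h j))
    p≢0 : NonZero p
    p≢0 = m*n≢0⇒m≢0 p {{subst NonZero eq (m*n≢0 q (sum h))}}
    cjq≢0 : NonZero (c j * q)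
    cjq≢0 = m*n≢0 (c j) q
  cj≤ : c j ≤ suc k * q
  cj≤ = largest-part-bound h {p = p} hj-max (hc j) eq
  bound : ∀ i → c i ≤ landauBound (suc k) q
  bound i with i ≟ j
  ... | yes refl = ≤-trans cj≤ (m≤m+n _ _)
  ... | no i≢j = begin
    c i                            ≡⟨ cong c (punchIn-punchOut j≢i) ⟨
    removeAt c j i′                ≤⟨ landau k (removeAt h j) (removeAt c j) {p = c j * p ∸ q}
                                        (hc ∘ punchIn j) (landau-remove h j {p = p} (hc j) eq) i′ ⟩
    landauBound k (c j * q)        ≤⟨ landauBound-mono-≤ (≤-refl {k}) (*-monoˡ-≤ q cj≤) ⟩
    landauBound k (suc k * q * q)  ≤⟨ m≤n+m _ _ ⟩
    landauBound (suc k) q          ∎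
    where
    open ≤-Reasoning
    j≢i = λ j≡i → i≢j (sym j≡i)
    i′ = punchOut j≢i

-- Counting over finite sets

indicator : Dec A → ℕ
indicator (yes _) = 1
indicator (no _)  = 0

indicator-yes : (a? : Dec A) → A → indicator a? ≡ 1
indicator-yes (yes _) _ = refl
indicator-yes (no ¬a) a = contradiction a ¬a

indicator-no : (a? : Dec A) → ¬ A → indicator a? ≡ 0
indicator-no (yes a) ¬a = contradiction a ¬a
indicator-no (no _)  _  = refl

indicator-cong : (a? : Dec A) (b? : Dec B) → A ⇔ B → indicator a? ≡ indicator b?
indicator-cong a? (yes b) a⇔b = indicator-yes a? (Equivalence.from a⇔b b)
indicator-cong a? (no ¬b) a⇔b = indicator-no a? (¬b ∘ Equivalence.to a⇔b)

count : {P : Predicate (Fin k) ℓ} → Decidable P → ℕ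
count P? = sum (indicator ∘ P?)

sum-ones : ∀ k → sum (λ (_ : Fin k) → 1) ≡ k
sum-ones zero    = refl
sum-ones (suc k) = cong suc (sum-ones k)

module _ {P : Predicate (Fin k) ℓ} (P? : Decidable P) where

  count-all : (∀ i → P i) → count P? ≡ k
  count-all all = trans (sum-cong-≗ (λ i → indicator-yes (P? i) (all i))) (sum-ones k)

  count-none : (∀ i → ¬ P i) → count P? ≡ 0
  count-none none =
    trans (sum-cong-≗ {y = λ _ → 0} (λ i → indicator-no (P? i) (none i))) (sum-replicate-zero k)

  count-permute : {Q : Predicate (Fin k) ℓ′} (Q? : Decidable Q) (π : Permutation′ k) →
                  (∀ i → P (π ⟨$⟩ʳ i) ⇔ Q i) → count P? ≡ count Q?
  count-permute Q? π P∘π⇔Q = trans (sum-permute (indicator ∘ P?) π)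
    (sum-cong-≗ (λ i → indicator-cong (P? _) (Q? i) (P∘π⇔Q i)))

count-unique : {P : Predicate (Fin k) ℓ} (P? : Decidable P) {i : Fin k} →
               P i → (∀ j → P j → j ≡ i) → count P? ≡ 1
count-unique {k = suc _} P? {i} Pi unique = begin
  count P?                                   ≡⟨ sum-remove (indicator ∘ P?) ⟩
  indicator (P? i) + count (P? ∘ punchIn i)  ≡⟨ cong₂ _+_ (indicator-yes (P? i) Pi) no-other ⟩
  1                                          ∎
  where
  open ≡-Reasoning
  no-other : count (P? ∘ punchIn i) ≡ 0
  no-other = count-none (P? ∘ punchIn i) (λ j → punchInᵢ≢i i j ∘ unique (punchIn i j))

count-partition : ∀ {m b} {P : Fin m → Predicate (Fin b) ℓ} (P? : ∀ i → Decidable (P i))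
                  (part : Fin b → Fin m) → (∀ y → P (part y) y) →
                  (∀ i y → P i y → i ≡ part y) → sum (λ i → count (P? i)) ≡ b
count-partition {b = b} P? part P-part unique = begin
  sum (λ i → count (P? i))          ≡⟨ ∑-comm (λ i y → indicator (P? i y)) ⟩
  sum (λ y → count (λ i → P? i y))
    ≡⟨ sum-cong-≗ (λ y → count-unique _ (P-part y) (λ i → unique i y)) ⟩
  sum (λ (_ : Fin b) → 1)           ≡⟨ sum-ones b ⟩
  b                                 ∎
  where open ≡-Reasoning

-- Transversals of a decidable equivalence

module _ {c ℓ} (S : DecSetoid c ℓ) where
  open DecSetoid S using (Carrier; _≈_) renaming (_≟_ to _≈?_; refl to ≈-refl; sym to ≈-sym)

  record Transversal (xs : List Carrier) : Set (c ⊔ ℓ) where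
    field
      size          : ℕ
      rep           : Fin size → Carrier
      rep-injective : ∀ {i j} → rep i ≈ rep j → i ≡ j
      rep-covers    : ∀ {x} → x ∈ xs → ∃ λ i → rep i ≈ x

  transversal : ∀ xs → Transversal xs
  transversal [] = record
    { size = 0 ; rep = λ () ; rep-injective = λ { {()} } ; rep-covers = λ () }
  transversal (x ∷ xs) with transversal xs
  ... | T with any? (λ i → Transversal.rep T i ≈? x)
  ... | yes (i , ri≈x) = record
    { size          = size
    ; rep           = rep
    ; rep-injective = rep-injective
    ; rep-covers    = λ { (here refl) → i , ri≈x ; (there y∈xs) → rep-covers y∈xs }
    }
    where open Transversal T
  ... | no x-new = record
    { size          = suc size
    ; rep           = x Vector.∷ rep
    ; rep-injective = injective
    ; rep-covers    = λ { (here refl)  → zero , ≈-refl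
                        ; (there y∈xs) → suc-cover (rep-covers y∈xs) }
    }
    where
    open Transversal T
    injective : ∀ {i j} → (x Vector.∷ rep) i ≈ (x Vector.∷ rep) j → i ≡ j
    injective {zero}  {zero}  _      = refl
    injective {zero}  {suc j} x≈rj   = contradiction (j , ≈-sym x≈rj) x-new
    injective {suc i} {zero}  ri≈x   = contradiction (i , ri≈x) x-new
    injective {suc i} {suc j} ri≈rj  = cong suc (rep-injective ri≈rj)
    suc-cover : ∀ {y} → ∃ (λ i → rep i ≈ y) → ∃ λ i → (x Vector.∷ rep) i ≈ y
    suc-cover (i , ri≈y) = suc i , ri≈y

-- Conjugacy classes

group : FinGroup → Group 0ℓ 0ℓ
group G = record
  { Carrier = Elt G
  ; _≈_     = _≡_
  ; _∙_     = _·_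
  ; ε       = e
  ; _⁻¹     = inv
  ; isGroup = record
    { isMonoid = record
      { isSemigroup = record
        { isMagma = record { isEquivalence = isEquivalence ; ∙-cong = cong₂ _·_ }
        ; assoc   = assoc
        }
      ; identity = idˡ , idʳ
      }
    ; inverse = invˡ , invʳ
    ; ⁻¹-cong = cong inv
    }
  }
  where open FinGroup G

module _ (G : FinGroup) where
  open FinGroup G
  open GroupProperties (group G) using (⁻¹-anti-homo-∙; ε⁻¹≈ε)

  conj : Elt G → Elt G → Elt G
  conj g x = (g · x) · inv g

  conj-∙ : ∀ g h x → conj (g · h) x ≡ conj g (conj h x)
  conj-∙ g h x = begin
    ((g · h) · x) · inv (g · h)      ≡⟨ cong (((g · h) · x) ·_) (⁻¹-anti-homo-∙ g h) ⟩
    ((g · h) · x) · (inv h · inv g)  ≡⟨ assoc (g · h) x _ ⟩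
    (g · h) · (x · (inv h · inv g))  ≡⟨ assoc g h _ ⟩
    g · (h · (x · (inv h · inv g)))  ≡⟨ cong (λ z → g · (h · z)) (assoc x (inv h) (inv g)) ⟨
    g · (h · ((x · inv h) · inv g))  ≡⟨ cong (g ·_) (assoc h (x · inv h) (inv g)) ⟨
    g · ((h · (x · inv h)) · inv g)  ≡⟨ cong (λ z → g · (z · inv g)) (assoc h x (inv h)) ⟨
    g · (conj h x · inv g)           ≡⟨ assoc g (conj h x) (inv g) ⟨
    conj g (conj h x)                ∎
    where open ≡-Reasoning

  conj-ε : ∀ x → conj e x ≡ x
  conj-ε x = trans (cong₂ _·_ (idˡ x) ε⁻¹≈ε) (idʳ x)

  conj-inverseˡ : ∀ g x → conj (inv g) (conj g x) ≡ x
  conj-inverseˡ g x =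
    trans (sym (conj-∙ (inv g) g x)) (trans (cong (λ h → conj h x) (invˡ g)) (conj-ε x))

  conj-injective : ∀ g {x y} → conj g x ≡ conj g y → x ≡ y
  conj-injective g {x} {y} gx≡gy =
    trans (sym (conj-inverseˡ g x)) (trans (cong (conj (inv g)) gx≡gy) (conj-inverseˡ g y))

  conj-fixes-e : ∀ g → conj g e ≡ e
  conj-fixes-e g = trans (cong (_· inv g) (idʳ g)) (invʳ g)

  conjugacy : DecSetoid 0ℓ 0ℓ
  conjugacy = record
    { Carrier          = Elt G
    ; _≈_              = Conj G
    ; isDecEquivalence = record
      { isEquivalence = record { refl = e , conj-ε _ ; sym = conj-sym ; trans = conj-trans }
      ; _≟_           = λ x y → any? (λ g → conj g x ≟ y)
      }
    }
    where
    conj-sym : ∀ {x y} → Conj G x y → Conj G y x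
    conj-sym {x} (g , refl) = inv g , conj-inverseˡ g x
    conj-trans : ∀ {x y z} → Conj G x y → Conj G y z → Conj G x z
    conj-trans {x} (g , refl) (h , refl) = h · g , conj-∙ h g x

  open DecSetoid conjugacy public
    using () renaming (refl to Conj-refl; sym to Conj-sym; trans to Conj-trans; _≟_ to Conj?)

  Conj-e : ∀ {x} → Conj G x e → x ≡ e
  Conj-e (g , gx≡e) = conj-injective g (trans gx≡e (sym (conj-fixes-e g)))

  centralizerSize : Elt G → ℕ
  centralizerSize x = count (λ g → conj g x ≟ x)

  classSize : Elt G → ℕ
  classSize x = count (Conj? x)

  fibreSize : Elt G → Elt G → ℕ
  fibreSize x y = count (λ g → conj g x ≟ y)

  centralizerSize-e : centralizerSize e ≡ order
  centralizerSize-e = count-all _ conj-fixes-e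

  -- g ↦ g₀ g maps the centralizer of x onto the g with conj g x ≡ conj g₀ x.
  fibreSize-conj : ∀ {x y} → Conj G x y → fibreSize x y ≡ centralizerSize x
  fibreSize-conj {x} (g₀ , refl) = count-permute _ _ translate λ g →
    mk⇔ (conj-injective g₀ ∘ trans (sym (conj-∙ g₀ g x)))
        (λ gx≡x → trans (conj-∙ g₀ g x) (cong (conj g₀) gx≡x))
    where
    translate = permutation (g₀ ·_) (inv g₀ ·_)
      (λ y → trans (sym (assoc _ _ _)) (trans (cong (_· y) (invʳ g₀)) (idˡ y)))
      (λ y → trans (sym (assoc _ _ _)) (trans (cong (_· y) (invˡ g₀)) (idˡ y)))

  fibreSize-¬conj : ∀ {x y} → ¬ Conj G x y → fibreSize x y ≡ 0
  fibreSize-¬conj ¬x~y = count-none _ (λ g gx≡y → ¬x~y (g , gx≡y))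

  orbit-stabilizer : ∀ x → classSize x * centralizerSize x ≡ order
  orbit-stabilizer x = begin
    classSize x * centralizerSize x
      ≡⟨ *-distribʳ-sum (centralizerSize x) (indicator ∘ Conj? x) ⟩
    sum (λ y → indicator (Conj? x y) * centralizerSize x)
      ≡⟨ sum-cong-≗ (λ y → fibre y (Conj? x y)) ⟨
    sum (fibreSize x)
      ≡⟨ count-partition (λ y g → conj g x ≟ y) (λ g → conj g x)
           (λ _ → refl) (λ _ _ → sym) ⟩
    order ∎
    where
    open ≡-Reasoning
    fibre : ∀ y (x~y? : Dec (Conj G x y)) → fibreSize x y ≡ indicator x~y? * centralizerSize x
    fibre y (yes x~y) = trans (fibreSize-conj x~y) (sym (+-identityʳ _))
    fibre y (no ¬x~y) = fibreSize-¬conj ¬x~y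

  class-equation : (r : Fin k → Elt G) → (∀ {i j} → Conj G (r i) (r j) → i ≡ j) →
                   (∀ y → ∃ λ i → Conj G (r i) y) → sum (classSize ∘ r) ≡ order
  class-equation r r-injective r-covers =
    count-partition (Conj? ∘ r) (proj₁ ∘ r-covers) (proj₂ ∘ r-covers)
      (λ i y ri~y → r-injective (Conj-trans ri~y (Conj-sym (proj₂ (r-covers y)))))

-- Solvability and the SCC-graph

module _ (G : FinGroup) where
  open FinGroup G

  ∩-subgroup : ∀ {S K : Pred G} → IsSubgroup G S → IsSubgroup G K →
               IsSubgroup G (λ a → S a × K a)
  ∩-subgroup (S-e , S-mul , S-inv) (K-e , K-mul , K-inv) =
    (S-e , K-e) ,
    (λ a b (Sa , Ka) (Sb , Kb) → S-mul a b Sa Sb , K-mul a b Ka Kb) ,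
    (λ a (Sa , Ka) → S-inv a Sa , K-inv a Ka)

  solvSeries-subgroup : ∀ {H S : Pred G} → SolvSeries G H → IsSubgroup G S →
                        (∀ a → S a → H a) → SolvSeries G S
  solvSeries-subgroup (trivial H-trivial) _ S⊆H = trivial (λ a → H-trivial a ∘ S⊆H a)
  solvSeries-subgroup {S = S} (step K K≤ _ K⊴H H/K-abelian series) S≤@(_ , S-mul , S-inv) S⊆H =
    step (λ a → S a × K a) S∩K≤ (λ _ → proj₁)
      (λ a k Sa (Sk , Kk) → S-mul _ _ (S-mul _ _ Sa Sk) (S-inv _ Sa) , K⊴H a k (S⊆H a Sa) Kk)
      (λ a b Sa Sb → S-comm Sa Sb , H/K-abelian a b (S⊆H a Sa) (S⊆H b Sb))
      (solvSeries-subgroup series S∩K≤ (λ _ → proj₂))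
    where
    S∩K≤ = ∩-subgroup S≤ K≤
    S-comm : ∀ {a b} → S a → S b → S (comm G a b)
    S-comm Sa Sb = S-mul _ _ (S-mul _ _ (S-mul _ _ Sa Sb) (S-inv _ Sa)) (S-inv _ Sb)

  gen₂-solvable : Solvable G → ∀ x y → SolvableSub G (Gen₂ G x y)
  gen₂-solvable (_ , series) x y = gen₂≤ , solvSeries-subgroup series gen₂≤ (λ _ _ → tt)
    where
    gen₂≤ : IsSubgroup G (Gen₂ G x y)
    gen₂≤ = ge , (λ _ _ → gmul) , (λ _ → ginv)

  solvable⇒clique : Solvable G → ∀ {m} (v : Fin m → Elt G) → (∀ i → ¬ v i ≡ e) →
                    (∀ i j → ¬ i ≡ j → ¬ Conj G (v i) (v j)) → IsClique G m v
  solvable⇒clique solvable v nontrivial distinct = nontrivial , distinct ,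
    λ i j _ → v i , v j , Conj-refl G , Conj-refl G , gen₂-solvable solvable (v i) (v j)

  classes≤suc-cliqueNumber : Solvable G → ∀ {d} → CliqueNumber G d →
                             ∀ {k} (r : Fin k → Elt G) → (∀ {i j} → Conj G (r i) (r j) → i ≡ j) →
                             ∀ i₀ → r i₀ ≡ e → k ≤ suc d
  classes≤suc-cliqueNumber solvable {d} (_ , maximal) {suc k} r r-injective i₀ r₀≡e =
    s≤s (maximal k r′ (solvable⇒clique solvable r′ nontrivial distinct))
    where
    r′ = r ∘ punchIn i₀
    nontrivial : ∀ i → ¬ r′ i ≡ e
    nontrivial i ri≡e =
      punchInᵢ≢i i₀ i (r-injective (subst (Conj G _) (trans ri≡e (sym r₀≡e)) (Conj-refl G)))
    distinct : ∀ i j → ¬ i ≡ j → ¬ Conj G (r′ i) (r′ j)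
    distinct i j i≢j = i≢j ∘ punchIn-injective i₀ i j ∘ r-injective

  order-bound : Solvable G → ∀ {d} → CliqueNumber G d → order ≤ landauBound (suc d) 1
  order-bound solvable {d} ω = begin
    order
      ≡⟨ trans (cong (centralizerSize G) rep₀≡e) (centralizerSize-e G) ⟨
    centralizerSize G (rep i₀)
      ≤⟨ landau size (classSize G ∘ rep) (centralizerSize G ∘ rep) {p = 1}
           (orbit-stabilizer G ∘ rep) (cong (1 *_) class-equation′) i₀ ⟩
    landauBound size 1
      ≤⟨ landauBound-mono-≤ classes≤ ≤-refl ⟩
    landauBound (suc d) 1 ∎
    where
    open ≤-Reasoning
    open Transversal (transversal (conjugacy G) (allFin order))
    instance
      order≢0 : NonZero order
      order≢0 = nonZeroIndex e
    i₀ = proj₁ (rep-covers (∈-allFin e))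
    rep₀≡e : rep i₀ ≡ e
    rep₀≡e = Conj-e G (proj₂ (rep-covers (∈-allFin e)))
    class-equation′ : sum (classSize G ∘ rep) ≡ order
    class-equation′ = class-equation G rep rep-injective (rep-covers ∘ ∈-allFin)
    classes≤ : size ≤ suc d
    classes≤ = classes≤suc-cliqueNumber solvable ω rep rep-injective i₀ rep₀≡e

-- Groups of bounded order

functions : ∀ a → List B → List (Fin a → B)
functions zero    bs = (λ ()) ∷ []
functions (suc a) bs = concatMap (λ b → map (b Vector.∷_) (functions a bs)) bs

functions-complete : (R : Rel B ℓ′) {bs : List B} → (∀ b → Any (R b) bs) →
                     ∀ a (f : Fin a → B) → Any (λ g → ∀ x → R (f x) (g x)) (functions a bs)
functions-complete R complete zero    f = here (λ ())
functions-complete R complete (suc a) f = concatMap⁺ _ (Any.map (λ Rf0b → map⁺ (Any.map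
  (λ { Rftg zero → Rf0b ; Rftg (suc x) → Rftg x }) (functions-complete R complete a (f ∘ suc))))
  (complete (f zero)))

module _ {n : ℕ} where

  GroupLaws : (Fin n → Fin n → Fin n) → Fin n → (Fin n → Fin n) → Set
  GroupLaws _·_ e inv = (∀ a b c → (a · b) · c ≡ a · (b · c))
                      × (∀ a → e · a ≡ a) × (∀ a → a · e ≡ a)
                      × (∀ a → inv a · a ≡ e) × (∀ a → a · inv a ≡ e)

  groupLaws? : ∀ _·_ e inv → Dec (GroupLaws _·_ e inv)
  groupLaws? _·_ e inv =
    all? (λ a → all? (λ b → all? (λ c → (a · b) · c ≟ a · (b · c))))
      ×-dec all? (λ a → e · a ≟ a) ×-dec all? (λ a → a · e ≟ a)
      ×-dec all? (λ a → inv a · a ≟ e) ×-dec all? (λ a → a · inv a ≟ e)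

  groupLaws-resp : ∀ {_·_ _∙_ e inv inv′} → (∀ a b → a · b ≡ a ∙ b) → inv ≗ inv′ →
                   GroupLaws _·_ e inv → GroupLaws _∙_ e inv′
  groupLaws-resp {_·_} {_∙_} ·≗∙ inv≗ (assoc , idˡ , idʳ , invˡ , invʳ) =
      (λ a b c → trans (sym (·≈∙ (·≗∙ a b) refl))
                       (trans (assoc a b c) (·≈∙ refl (·≗∙ b c))))
    , (λ a → trans (sym (·≈∙ refl refl)) (idˡ a))
    , (λ a → trans (sym (·≈∙ refl refl)) (idʳ a))
    , (λ a → trans (sym (·≈∙ (inv≗ a) refl)) (invˡ a))
    , (λ a → trans (sym (·≈∙ refl (inv≗ a))) (invʳ a))
    where
    ·≈∙ : ∀ {a a′ b b′} → a ≡ a′ → b ≡ b′ → a · b ≡ a′ ∙ b′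
    ·≈∙ {a} {b = b} a≡a′ b≡b′ = trans (·≗∙ a b) (cong₂ _∙_ a≡a′ b≡b′)

  groupFromTable : ∀ _·_ e inv → Dec (GroupLaws _·_ e inv) → List FinGroup
  groupFromTable _·_ e inv (yes (assoc , idˡ , idʳ , invˡ , invʳ)) =
    record { order = n ; _·_ = _·_ ; e = e ; inv = inv
           ; assoc = assoc ; idˡ = idˡ ; idʳ = idʳ ; invˡ = invˡ ; invʳ = invʳ } ∷ []
  groupFromTable _·_ e inv (no _) = []

  groupsWithProduct : (Fin n → Fin n → Fin n) → Fin n → List FinGroup
  groupsWithProduct _·_ e =
    concatMap (λ inv → groupFromTable _·_ e inv (groupLaws? _·_ e inv)) (functions n (allFin n))

groupsOfOrder : ℕ → List FinGroup
groupsOfOrder n = concatMap (λ _·_ → concatMap (groupsWithProduct _·_) (allFin n))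
                            (functions n (functions n (allFin n)))

module _ (G : FinGroup) where
  open FinGroup G

  groupFromTable-complete : ∀ {_∙_ inv′} → (∀ a b → a · b ≡ a ∙ b) → inv ≗ inv′ →
                            (laws? : Dec (GroupLaws _∙_ e inv′)) →
                            Any (G ≅_) (groupFromTable _∙_ e inv′ laws?)
  groupFromTable-complete ·≗∙ _ (yes _) = here record
    { to = λ a → a ; from = λ a → a ; from∘to = λ _ → refl ; to∘from = λ _ → refl
    ; hom = ·≗∙ }
  groupFromTable-complete ·≗∙ inv≗ (no ¬laws) =
    contradiction (groupLaws-resp ·≗∙ inv≗ (assoc , idˡ , idʳ , invˡ , invʳ)) ¬laws

  groupsWithProduct-complete : ∀ {_∙_} → (∀ a b → a · b ≡ a ∙ b) →
                               Any (G ≅_) (groupsWithProduct _∙_ e)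
  groupsWithProduct-complete {_∙_} ·≗∙ = concatMap⁺ _ (Any.map
    (λ {inv′} inv≗ → groupFromTable-complete ·≗∙ inv≗ (groupLaws? _∙_ e inv′))
    (functions-complete _≡_ ∈-allFin order inv))

  groupsOfOrder-complete : Any (G ≅_) (groupsOfOrder order)
  groupsOfOrder-complete = concatMap⁺ _ (Any.map
    (λ ·≗∙ → concatMap⁺ _
      (Any.map (λ { refl → groupsWithProduct-complete ·≗∙ }) (∈-allFin e)))
    (functions-complete _≗_ (functions-complete _≡_ ∈-allFin order) order _·_))

groupsOfOrderAtMost : ℕ → List FinGroup
groupsOfOrderAtMost N = concatMap groupsOfOrder (upTo (suc N))

groupsOfOrderAtMost-complete : ∀ {N} G → FinGroup.order G ≤ N → Any (G ≅_) (groupsOfOrderAtMost N)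
groupsOfOrderAtMost-complete G order≤N = concatMap⁺ groupsOfOrder
  (Any.map (λ { refl → groupsOfOrder-complete G }) (∈-upTo⁺ (s≤s order≤N)))

-- The bound holds for every d.
mainTheorem7 : (d : ℕ) → 1 ≤ d →
    Σ (List FinGroup) λ L →
      (G : FinGroup) → Solvable G → CliqueNumber G d → Any (λ H → G ≅ H) L
mainTheorem7 d _ = groupsOfOrderAtMost (landauBound (suc d) 1) ,
  λ G solvable ω → groupsOfOrderAtMost-complete G (order-bound G solvable ω)
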